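{- Let $q>1$ be a prime power, let $n>4$ be an integer, let $p(n)$ be the least prime divisor of $n$, and set $L_n(q)=(q-1)q^{\,n-n/p(n)-1}$. Then $$L_n(q)\geq q-1+\frac{n-2}{2}(q-1)^2+\frac{(n-2)(n-4)}{8}(q-1)^3>\frac{(n-1)^2}{8}.$$ Moreover, if $n\geq 6$, then $$L_n(q)\geq q-1+\frac{n-2}{2}(q-1)^2+\frac{n^2-6n+8}{8}(q-1)^3+\frac{n^3-12n^2+44n-48}{48}(q-1)^4.$$ -}

module Defs where

open import Data.Nat as ℕ using (ℕ; zero; suc; _∸_; _≤_)
open import Data.Nat.Divisibility using (_∣_)
open import Data.Nat.Primality using (Prime; prime⇒nonZero)
open import Data.Product using (Σ; _×_; ∃₂)
open import Data.Integer using (+_)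
open import Data.Rational as ℚ using (ℚ; _/_; 1ℚ; _*_)
open import Relation.Binary.PropositionalEquality using (_≡_)

IsPrimePower : ℕ → Set
IsPrimePower q = ∃₂ λ r k → Prime r × 1 ≤ k × q ≡ r ℕ.^ k

record IsLeastPrimeDivisor (n p : ℕ) : Set where
  field
    prime   : Prime p
    divides : p ∣ n
    least   : ∀ r → Prime r → r ∣ n → p ≤ r

Lfun : (q n p : ℕ) → Prime p → ℕ
Lfun q n p pr = (q ∸ 1) ℕ.* q ℕ.^ (n ∸ ℕ._/_ n p {{prime⇒nonZero pr}} ∸ 1)

ι : ℕ → ℚ
ι k = + k / 1

infixr 8 _^ℚ_
_^ℚ_ : ℚ → ℕ → ℚ
x ^ℚ zero = 1ℚ
x ^ℚ suc k = x * (x ^ℚ k)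

{-# OPTIONS --safe #-}
module Submission where

-- With x = q - 1, m = n - n/p - 1 and p ≥ 2 we have L = x (1 + x)^m and n ≤ 2m + 2.
-- Truncating the binomial expansion gives
--   (1 + x)^m ≥ 1 + m x + C(m,2) x² + C(m,3) x³,
-- and, each coefficient being increasing in m ≥ 2, they dominate their values at
-- m = (n - 2)/2, which are exactly (n - 2)/2, (n - 2)(n - 4)/8 and (n - 2)(n - 4)(n - 6)/48.
-- At x = 1 the cubic bound equals ((n - 1)² + 7)/8, and it increases with x.
-- After clearing denominators all of this is an inequality between polynomials with
-- natural coefficients, proved in ℕ and carried over to ℚ along ι.

open import Defs
open import Data.Nat as ℕ using (ℕ; zero; suc; _∸_; s≤s; _<_; _≤_)
open import Data.Nat.Properties as ℕₚ using (≤-refl; ≤-trans; ≤-reflexive)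
open import Data.Nat.DivMod using (/-monoʳ-≤; m/n*n≤m)
open import Data.Nat.Primality using (Prime; prime⇒nonZero; prime⇒nonTrivial)
import Data.Nat.Solver as ℕSolver
open import Data.Integer as ℤ using (+_)
import Data.Integer.Properties as ℤₚ
open import Data.Rational as ℚ using (ℚ; mkℚ; 1ℚ)
import Data.Rational.Properties as ℚₚ
import Data.Rational.Solver as ℚSolver
open import Data.Nat.Coprimality using (1-coprimeTo)
import Data.Nat.Coprimality as Coprime
open import Data.Product using (_×_; _,_; ∃-syntax)
open import Function using (id)
open import Relation.Nullary using (contradiction)
open import Relation.Binary.PropositionalEquality

ι-≡-mkℚ : ∀ a → ι a ≡ mkℚ (+ a) 0 (Coprime.sym (1-coprimeTo a))
ι-≡-mkℚ a = ℚₚ.normalize-coprime (Coprime.sym (1-coprimeTo a))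

ι-+ : ∀ a b → ι (a ℕ.+ b) ≡ ι a ℚ.+ ι b
ι-+ a b = begin
  ι (a ℕ.+ b)                         ≡⟨ cong (ℚ._/ 1) (ℤₚ.pos-+ a b) ⟩
  (+ a ℤ.+ + b) ℚ./ 1                 ≡⟨ cong (ℚ._/ 1) (sym (cong₂ ℤ._+_ (ℤₚ.*-identityʳ (+ a)) (ℤₚ.*-identityʳ (+ b)))) ⟩
  (+ a ℤ.* + 1 ℤ.+ + b ℤ.* + 1) ℚ./ 1 ≡⟨ sym (cong₂ ℚ._+_ (ι-≡-mkℚ a) (ι-≡-mkℚ b)) ⟩
  ι a ℚ.+ ι b                         ∎
  where open ≡-Reasoning

ι-* : ∀ a b → ι (a ℕ.* b) ≡ ι a ℚ.* ι b
ι-* a b = begin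
  ι (a ℕ.* b)            ≡⟨ cong (ℚ._/ 1) (ℤₚ.pos-* a b) ⟩
  (+ a ℤ.* + b) ℚ./ 1    ≡⟨ sym (cong₂ ℚ._*_ (ι-≡-mkℚ a) (ι-≡-mkℚ b)) ⟩
  ι a ℚ.* ι b            ∎
  where open ≡-Reasoning

ι-mono-≤ : ∀ {a b} → a ≤ b → ι a ℚ.≤ ι b
ι-mono-≤ {a} {b} a≤b rewrite ι-≡-mkℚ a | ι-≡-mkℚ b =
  ℚ.*≤* (subst₂ ℤ._≤_ (sym (ℤₚ.*-identityʳ (+ a))) (sym (ℤₚ.*-identityʳ (+ b))) (ℤ.+≤+ a≤b))

ι-mono-< : ∀ {a b} → a < b → ι a ℚ.< ι b
ι-mono-< {a} {b} a<b rewrite ι-≡-mkℚ a | ι-≡-mkℚ b =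
  ℚ.*<* (subst₂ ℤ._<_ (sym (ℤₚ.*-identityʳ (+ a))) (sym (ℤₚ.*-identityʳ (+ b))) (ℤ.+<+ a<b))

infixl 6 _⊕_
infixl 7 _⊗_

-- The polynomials of the argument are written once as syntax and then evaluated in ℕ,
-- where the inequalities are proved, in ℚ, where they are stated, and into the syntax
-- of the ring solvers.

data Poly₂ : Set where
  ‵_      : ℕ → Poly₂
  K X     : Poly₂
  _⊕_ _⊗_ : Poly₂ → Poly₂ → Poly₂

module _ {A : Set} (lit : ℕ → A) (_+_ _*_ : A → A → A) where

  eval : Poly₂ → A → A → A
  eval (‵ c)   k x = lit c
  eval K       k x = k
  eval X       k x = x
  eval (p ⊕ q) k x = eval p k x + eval q k x
  eval (p ⊗ q) k x = eval p k x * eval q k x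

⟦_⟧ : Poly₂ → ℕ → ℕ → ℕ
⟦_⟧ = eval id ℕ._+_ ℕ._*_

⟦_⟧ℚ : Poly₂ → ℚ → ℚ → ℚ
⟦_⟧ℚ = eval ι ℚ._+_ ℚ._*_

⟦⟧-mono : ∀ p {k k′ x x′} → k ≤ k′ → x ≤ x′ → ⟦ p ⟧ k x ≤ ⟦ p ⟧ k′ x′
⟦⟧-mono (‵ c)   k≤ x≤ = ≤-refl
⟦⟧-mono K       k≤ x≤ = k≤
⟦⟧-mono X       k≤ x≤ = x≤
⟦⟧-mono (p ⊕ q) k≤ x≤ = ℕₚ.+-mono-≤ (⟦⟧-mono p k≤ x≤) (⟦⟧-mono q k≤ x≤)
⟦⟧-mono (p ⊗ q) k≤ x≤ = ℕₚ.*-mono-≤ (⟦⟧-mono p k≤ x≤) (⟦⟧-mono q k≤ x≤)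

ι-⟦⟧ : ∀ p k x → ι (⟦ p ⟧ k x) ≡ ⟦ p ⟧ℚ (ι k) (ι x)
ι-⟦⟧ (‵ c)   k x = refl
ι-⟦⟧ K       k x = refl
ι-⟦⟧ X       k x = refl
ι-⟦⟧ (p ⊕ q) k x = trans (ι-+ (⟦ p ⟧ k x) (⟦ q ⟧ k x)) (cong₂ ℚ._+_ (ι-⟦⟧ p k x) (ι-⟦⟧ q k x))
ι-⟦⟧ (p ⊗ q) k x = trans (ι-* (⟦ p ⟧ k x) (⟦ q ⟧ k x)) (cong₂ ℚ._*_ (ι-⟦⟧ p k x) (ι-⟦⟧ q k x))

-- 8 times the cubic bound at n = 5 + K, 48 times the quartic bound at n = 6 + K,
-- and 8 times (n - 1)²/8 at n = 5 + K, where q = 1 + X.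
cubicPoly quarticPoly squarePoly : Poly₂
cubicPoly = ‵ 8 ⊗ X ⊕ ‵ 4 ⊗ (‵ 3 ⊕ K) ⊗ (X ⊗ X) ⊕ (‵ 3 ⊕ K) ⊗ (‵ 1 ⊕ K) ⊗ (X ⊗ X ⊗ X)
quarticPoly = ‵ 48 ⊗ X ⊕ ‵ 24 ⊗ (‵ 4 ⊕ K) ⊗ (X ⊗ X) ⊕ ‵ 6 ⊗ (‵ 4 ⊕ K) ⊗ (‵ 2 ⊕ K) ⊗ (X ⊗ X ⊗ X)
              ⊕ (‵ 4 ⊕ K) ⊗ (‵ 2 ⊕ K) ⊗ K ⊗ (X ⊗ X ⊗ X ⊗ X)
squarePoly = (‵ 4 ⊕ K) ⊗ (‵ 4 ⊕ K)

module _ where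
  open import Data.Nat using (_+_; _*_; _^_)
  open ℕSolver.+-*-Solver using (Polynomial; con; _:+_; _:*_; _:^_; _:=_; solve)

  ⟪_⟫ : ∀ {m} → Poly₂ → Polynomial m → Polynomial m → Polynomial m
  ⟪_⟫ = eval con _:+_ _:*_

  quartic-binomial : ∀ j x → ⟦ quarticPoly ⟧ (2 * j) x ≤ 48 * (x * (1 + x) ^ (2 + j))
  quartic-binomial zero x = ≤-reflexive
    (solve 1 (λ x → ⟪ quarticPoly ⟫ (con 0) x := con 48 :* (x :* (con 1 :+ x) :^ 2)) refl x)
  quartic-binomial (suc j) x = begin
    ⟦ quarticPoly ⟧ (2 * suc j) x                                       ≤⟨ ℕₚ.m≤m+n _ _ ⟩
    ⟦ quarticPoly ⟧ (2 * suc j) x + 8 * (2 + j) * (1 + j) * j * x ^ 5  ≡⟨ pascal j x ⟩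
    (1 + x) * ⟦ quarticPoly ⟧ (2 * j) x                                 ≤⟨ ℕₚ.*-monoʳ-≤ (1 + x) (quartic-binomial j x) ⟩
    (1 + x) * (48 * (x * (1 + x) ^ (2 + j)))                            ≡⟨ shift x ((1 + x) ^ (2 + j)) ⟩
    48 * (x * (1 + x) ^ (3 + j))                                        ∎
    where
    open ℕₚ.≤-Reasoning
    shift : ∀ x y → (1 + x) * (48 * (x * y)) ≡ 48 * (x * ((1 + x) * y))
    shift = solve 2 (λ x y → (con 1 :+ x) :* (con 48 :* (x :* y)) := con 48 :* (x :* ((con 1 :+ x) :* y))) refl
    -- ⟦ quarticPoly ⟧ (2 j) x = 48 x Σ_{i ≤ 3} C(2 + j, i) xⁱ, so this is Pascal's rule for that sum.
    pascal : ∀ j x → ⟦ quarticPoly ⟧ (2 * suc j) x + 8 * (2 + j) * (1 + j) * j * x ^ 5 ≡ (1 + x) * ⟦ quarticPoly ⟧ (2 * j) x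
    pascal = solve 2 (λ j x → ⟪ quarticPoly ⟫ (con 2 :* (con 1 :+ j)) x :+ con 8 :* (con 2 :+ j) :* (con 1 :+ j) :* j :* x :^ 5
                               := (con 1 :+ x) :* ⟪ quarticPoly ⟫ (con 2 :* j) x) refl

  6*cubic≤quartic : ∀ k x → 6 * ⟦ cubicPoly ⟧ (1 + k) x ≤ ⟦ quarticPoly ⟧ k x
  6*cubic≤quartic k x = ℕₚ.m+n≤o⇒m≤o _ (≤-reflexive (solve 2 (λ k x →
    con 6 :* ⟪ cubicPoly ⟫ (con 1 :+ k) x :+ (con 4 :+ k) :* (con 2 :+ k) :* k :* x :^ 4 := ⟪ quarticPoly ⟫ k x) refl k x))

  cubic-at-1 : ∀ k → ⟦ cubicPoly ⟧ k 1 ≡ 7 + ⟦ squarePoly ⟧ k 1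
  cubic-at-1 = solve 1 (λ k → ⟪ cubicPoly ⟫ k (con 1) := con 7 :+ ⟪ squarePoly ⟫ k (con 1)) refl

  square<cubic : ∀ k {x} → 1 ≤ x → ⟦ squarePoly ⟧ k 1 < ⟦ cubicPoly ⟧ k x
  square<cubic k {x} 1≤x = begin-strict
    ⟦ squarePoly ⟧ k 1       <⟨ ℕₚ.m<n+m _ {7} (s≤s ℕ.z≤n) ⟩
    7 + ⟦ squarePoly ⟧ k 1   ≡⟨ cubic-at-1 k ⟨
    ⟦ cubicPoly ⟧ k 1        ≤⟨ ⟦⟧-mono cubicPoly (≤-refl {k}) 1≤x ⟩
    ⟦ cubicPoly ⟧ k x        ∎
    where open ℕₚ.≤-Reasoning

  quartic-≤ : ∀ {k j} x → k ≤ 2 * j → ⟦ quarticPoly ⟧ k x ≤ 48 * (x * (1 + x) ^ (2 + j))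
  quartic-≤ {j = j} x k≤2j = ≤-trans (⟦⟧-mono quarticPoly k≤2j (≤-refl {x})) (quartic-binomial j x)

  cubic-≤ : ∀ {k j} x → k ≤ 1 + 2 * j → ⟦ cubicPoly ⟧ k x ≤ 8 * (x * (1 + x) ^ (2 + j))
  cubic-≤ {k} {j} x k≤ = ℕₚ.*-cancelˡ-≤ 6 (begin
    6 * ⟦ cubicPoly ⟧ k x               ≤⟨ ℕₚ.*-monoʳ-≤ 6 (⟦⟧-mono cubicPoly k≤ (≤-refl {x})) ⟩
    6 * ⟦ cubicPoly ⟧ (1 + 2 * j) x     ≤⟨ 6*cubic≤quartic (2 * j) x ⟩
    ⟦ quarticPoly ⟧ (2 * j) x           ≤⟨ quartic-binomial j x ⟩
    48 * (x * (1 + x) ^ (2 + j))        ≡⟨ ℕₚ.*-assoc 6 8 (x * (1 + x) ^ (2 + j)) ⟩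
    6 * (8 * (x * (1 + x) ^ (2 + j)))   ∎)
    where open ℕₚ.≤-Reasoning

  exponent-split : ∀ {n p} (pr : Prime p) → 4 < n →
                   ∃[ j ] (n ∸ (n ℕ./ p) {{prime⇒nonZero pr}} ∸ 1 ≡ 2 + j × n ≤ 6 + 2 * j)
  exponent-split {n} {p} pr 4<n = split (n ∸ d) n≤2[n∸d]
    where
    open ℕₚ.≤-Reasoning
    instance _ = prime⇒nonZero pr
    d : ℕ
    d = n ℕ./ p
    d+d≤n : d + d ≤ n
    d+d≤n = begin
      d + d               ≤⟨ ℕₚ.+-mono-≤ (/-monoʳ-≤ n 2≤p) (/-monoʳ-≤ n 2≤p) ⟩
      n ℕ./ 2 + n ℕ./ 2   ≡⟨ solve 1 (λ h → h :+ h := h :* con 2) refl (n ℕ./ 2) ⟩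
      n ℕ./ 2 * 2         ≤⟨ m/n*n≤m n 2 ⟩
      n                   ∎
      where
      2≤p : 2 ≤ p
      2≤p = ℕ.nonTrivial⇒n>1 p {{prime⇒nonTrivial pr}}
    n≤2[n∸d] : n ≤ 2 * (n ∸ d)
    n≤2[n∸d] = begin
      n                   ≡⟨ ℕₚ.m+[n∸m]≡n (ℕₚ.m+n≤o⇒m≤o d d+d≤n) ⟨
      d + (n ∸ d)         ≤⟨ ℕₚ.+-monoˡ-≤ (n ∸ d) (ℕₚ.m+n≤o⇒m≤o∸n d d+d≤n) ⟩
      (n ∸ d) + (n ∸ d)   ≡⟨ cong (λ e → (n ∸ d) + e) (ℕₚ.+-identityʳ (n ∸ d)) ⟨
      2 * (n ∸ d)         ∎
    split : ∀ e → n ≤ 2 * e → ∃[ j ] (e ∸ 1 ≡ 2 + j × n ≤ 6 + 2 * j)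
    split 0 n≤0 = contradiction (≤-trans 4<n n≤0) λ ()
    split 1 n≤2 = contradiction (≤-trans 4<n n≤2) λ { (s≤s (s≤s ())) }
    split 2 n≤4 = contradiction (≤-trans 4<n n≤4) λ { (s≤s (s≤s (s≤s (s≤s ())))) }
    split (suc (suc (suc j))) n≤ = j , refl , ≤-trans n≤ (≤-reflexive (ℕₚ.*-distribˡ-+ 2 3 j))

open import Data.Rational using (_/_; _+_; _-_; _*_; _≥_; _>_)

cubicBound quarticBound : ℚ → ℚ → ℚ
cubicBound n q =
  (q - ι 1) + (n - ι 2) * (+ 1 / 2) * (q - ι 1) ^ℚ 2
    + (n - ι 2) * (n - ι 4) * (+ 1 / 8) * (q - ι 1) ^ℚ 3
quarticBound n q =
  (q - ι 1) + (n - ι 2) * (+ 1 / 2) * (q - ι 1) ^ℚ 2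
    + (n ^ℚ 2 - ι 6 * n + ι 8) * (+ 1 / 8) * (q - ι 1) ^ℚ 3
    + (n ^ℚ 3 - ι 12 * n ^ℚ 2 + ι 44 * n - ι 48) * (+ 1 / 48) * (q - ι 1) ^ℚ 4

ι-identity : ∀ (f : ℚ → ℚ → ℚ) c p r → (∀ K X → f (ι c + K) (ι 1 + X) ≡ ⟦ p ⟧ℚ K X * r) →
             ∀ k x → f (ι (c ℕ.+ k)) (ι (suc x)) ≡ ι (⟦ p ⟧ k x) * r
ι-identity f c p r identity k x = begin
  f (ι (c ℕ.+ k)) (ι (suc x))    ≡⟨ cong₂ f (ι-+ c k) (ι-+ 1 x) ⟩
  f (ι c + ι k) (ι 1 + ι x)      ≡⟨ identity (ι k) (ι x) ⟩
  ⟦ p ⟧ℚ (ι k) (ι x) * r         ≡⟨ cong (_* r) (ι-⟦⟧ p k x) ⟨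
  ι (⟦ p ⟧ k x) * r              ∎
  where open ≡-Reasoning

module _ where
  open ℚSolver.+-*-Solver using (Polynomial; con; _:+_; _:-_; _:*_; _:^_; _:=_; solve)

  ⟪_⟫ℚ : ∀ {m} → Poly₂ → Polynomial m → Polynomial m → Polynomial m
  ⟪_⟫ℚ = eval (λ c → con (ι c)) _:+_ _:*_

  cubicBound-≡ : ∀ k x → cubicBound (ι (5 ℕ.+ k)) (ι (suc x)) ≡ ι (⟦ cubicPoly ⟧ k x) * (+ 1 / 8)
  cubicBound-≡ = ι-identity cubicBound 5 cubicPoly (+ 1 / 8) (solve 2 (λ K X →
    let n = con (ι 5) :+ K ; y = con (ι 1) :+ X :- con (ι 1) in
    y :+ (n :- con (ι 2)) :* con (+ 1 / 2) :* y :^ 2 :+ (n :- con (ι 2)) :* (n :- con (ι 4)) :* con (+ 1 / 8) :* y :^ 3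
      := ⟪ cubicPoly ⟫ℚ K X :* con (+ 1 / 8)) refl)

  quarticBound-≡ : ∀ k x → quarticBound (ι (6 ℕ.+ k)) (ι (suc x)) ≡ ι (⟦ quarticPoly ⟧ k x) * (+ 1 / 48)
  quarticBound-≡ = ι-identity quarticBound 6 quarticPoly (+ 1 / 48) (solve 2 (λ K X →
    let n = con (ι 6) :+ K ; y = con (ι 1) :+ X :- con (ι 1) in
    y :+ (n :- con (ι 2)) :* con (+ 1 / 2) :* y :^ 2
      :+ (n :^ 2 :- con (ι 6) :* n :+ con (ι 8)) :* con (+ 1 / 8) :* y :^ 3
      :+ (n :^ 3 :- con (ι 12) :* n :^ 2 :+ con (ι 44) :* n :- con (ι 48)) :* con (+ 1 / 48) :* y :^ 4
      := ⟪ quarticPoly ⟫ℚ K X :* con (+ 1 / 48)) refl)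

  square-≡ : ∀ k x → (ι (5 ℕ.+ k) - ι 1) ^ℚ 2 * (+ 1 / 8) ≡ ι (⟦ squarePoly ⟧ k x) * (+ 1 / 8)
  square-≡ = ι-identity (λ n _ → (n - ι 1) ^ℚ 2 * (+ 1 / 8)) 5 squarePoly (+ 1 / 8) (solve 2 (λ K X →
    (con (ι 5) :+ K :- con (ι 1)) :^ 2 :* con (+ 1 / 8) := ⟪ squarePoly ⟫ℚ K X :* con (+ 1 / 8)) refl)

  ι-≤-scaled : ∀ {a} c b (r : ℚ) .{{_ : ℚ.NonNegative r}} → ι c * r ≡ 1ℚ → a ℕ.≤ c ℕ.* b → ι a * r ℚ.≤ ι b
  ι-≤-scaled {a} c b r cr≡1 a≤cb = begin
    ι a * r          ≤⟨ ℚₚ.*-monoʳ-≤-nonNeg r (ι-mono-≤ a≤cb) ⟩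
    ι (c ℕ.* b) * r  ≡⟨ cong (_* r) (ι-* c b) ⟩
    ι c * ι b * r    ≡⟨ solve 3 (λ c b r → c :* b :* r := b :* (c :* r)) refl (ι c) (ι b) r ⟩
    ι b * (ι c * r)  ≡⟨ cong (ι b *_) cr≡1 ⟩
    ι b * 1ℚ         ≡⟨ ℚₚ.*-identityʳ (ι b) ⟩
    ι b              ∎
    where open ℚₚ.≤-Reasoning

cubicBound-≤ : ∀ {n j} x → 4 < n → n ≤ 6 ℕ.+ 2 ℕ.* j → cubicBound (ι n) (ι (suc x)) ℚ.≤ ι (x ℕ.* suc x ℕ.^ (2 ℕ.+ j))
cubicBound-≤ {j = j} x 4<n n≤ with k , refl ← ℕₚ.m≤n⇒∃[o]m+o≡n 4<n = begin
  cubicBound (ι (5 ℕ.+ k)) (ι (suc x))  ≡⟨ cubicBound-≡ k x ⟩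
  ι (⟦ cubicPoly ⟧ k x) * (+ 1 / 8)     ≤⟨ ι-≤-scaled 8 L (+ 1 / 8) refl (cubic-≤ {j = j} x k≤1+2j) ⟩
  ι L                                   ∎
  where
  open ℚₚ.≤-Reasoning
  L : ℕ
  L = x ℕ.* suc x ℕ.^ (2 ℕ.+ j)
  k≤1+2j : k ≤ 1 ℕ.+ 2 ℕ.* j
  k≤1+2j = ℕₚ.+-cancelˡ-≤ 5 k (1 ℕ.+ 2 ℕ.* j) n≤

cubicBound->-square : ∀ {n} x → 4 < n → 1 ≤ x → cubicBound (ι n) (ι (suc x)) > (ι n - ι 1) ^ℚ 2 * (+ 1 / 8)
cubicBound->-square x 4<n 1≤x with k , refl ← ℕₚ.m≤n⇒∃[o]m+o≡n 4<n = begin-strict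
  (ι (5 ℕ.+ k) - ι 1) ^ℚ 2 * (+ 1 / 8)     ≡⟨ square-≡ k 1 ⟩
  ι (⟦ squarePoly ⟧ k 1) * (+ 1 / 8)       <⟨ ℚₚ.*-monoˡ-<-pos (+ 1 / 8) (ι-mono-< (square<cubic k 1≤x)) ⟩
  ι (⟦ cubicPoly ⟧ k x) * (+ 1 / 8)        ≡⟨ cubicBound-≡ k x ⟨
  cubicBound (ι (5 ℕ.+ k)) (ι (suc x))     ∎
  where open ℚₚ.≤-Reasoning

quarticBound-≤ : ∀ {n j} x → 6 ≤ n → n ≤ 6 ℕ.+ 2 ℕ.* j → quarticBound (ι n) (ι (suc x)) ℚ.≤ ι (x ℕ.* suc x ℕ.^ (2 ℕ.+ j))
quarticBound-≤ {j = j} x 6≤n n≤ with k , refl ← ℕₚ.m≤n⇒∃[o]m+o≡n 6≤n = begin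
  quarticBound (ι (6 ℕ.+ k)) (ι (suc x))  ≡⟨ quarticBound-≡ k x ⟩
  ι (⟦ quarticPoly ⟧ k x) * (+ 1 / 48)    ≤⟨ ι-≤-scaled 48 L (+ 1 / 48) refl (quartic-≤ {j = j} x k≤2j) ⟩
  ι L                                     ∎
  where
  open ℚₚ.≤-Reasoning
  L : ℕ
  L = x ℕ.* suc x ℕ.^ (2 ℕ.+ j)
  k≤2j : k ≤ 2 ℕ.* j
  k≤2j = ℕₚ.+-cancelˡ-≤ 6 k (2 ℕ.* j) n≤

lemma2p3 : (q n p : ℕ) → IsPrimePower q → 1 < q → 4 < n →
  (lp : IsLeastPrimeDivisor n p) →
  ((ι (Lfun q n p (IsLeastPrimeDivisor.prime lp)) ≥
      (ι q - ι 1) + (ι n - ι 2) * (+ 1 / 2) * (ι q - ι 1) ^ℚ 2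
        + (ι n - ι 2) * (ι n - ι 4) * (+ 1 / 8) * (ι q - ι 1) ^ℚ 3)
   × ((ι q - ι 1) + (ι n - ι 2) * (+ 1 / 2) * (ι q - ι 1) ^ℚ 2
        + (ι n - ι 2) * (ι n - ι 4) * (+ 1 / 8) * (ι q - ι 1) ^ℚ 3
      > (ι n - ι 1) ^ℚ 2 * (+ 1 / 8)))
  × (6 ≤ n →
     ι (Lfun q n p (IsLeastPrimeDivisor.prime lp)) ≥
       (ι q - ι 1) + (ι n - ι 2) * (+ 1 / 2) * (ι q - ι 1) ^ℚ 2
         + (ι n ^ℚ 2 - ι 6 * ι n + ι 8) * (+ 1 / 8) * (ι q - ι 1) ^ℚ 3
         + (ι n ^ℚ 3 - ι 12 * ι n ^ℚ 2 + ι 44 * ι n - ι 48) * (+ 1 / 48) * (ι q - ι 1) ^ℚ 4)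
lemma2p3 (suc x) n p _ (s≤s 1≤x) 4<n record { prime = pr }
  with j , m≡2+j , n≤6+2j ← exponent-split pr 4<n
  = ( ( ℚₚ.≤-trans (cubicBound-≤ {j = j} x 4<n n≤6+2j) (ℚₚ.≤-reflexive (sym L≡))
      , cubicBound->-square x 4<n 1≤x )
    , λ 6≤n → ℚₚ.≤-trans (quarticBound-≤ {j = j} x 6≤n n≤6+2j) (ℚₚ.≤-reflexive (sym L≡)) )
  where
  L≡ : ι (Lfun (suc x) n p pr) ≡ ι (x ℕ.* suc x ℕ.^ (2 ℕ.+ j))
  L≡ = cong (λ m → ι (x ℕ.* suc x ℕ.^ m)) m≡2+j
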